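{- Let $G[U]$ be a maximum induced interval subgraph of a graph $G$. Let $M$ be a module of $G$ such that at least one of $M$ and $N(M)$ induces a clique. If $M\cap U\ne\emptyset$, then for every maximum induced interval subgraph $G[U_M]$ of $G[M]$, the graph $G[(U\setminus M)\cup U_M]$ is a maximum induced interval subgraph of $G$.
   Context: Graphs are finite, simple, undirected. A module of $G$ is a set $M\subseteq V(G)$ such that every vertex outside $M$ is adjacent to all or none of $M$; $N(M)$ denotes the set of vertices outside $M$ adjacent to some vertex of $M$. A maximum induced interval subgraph of $G$ is an induced subgraph $G[U]$ that is an interval graph with $|U|$ maximum. -}

module Defs where

open import Data.Nat using (ℕ; _≤_)
open import Data.Fin using (Fin)
open import Data.Fin.Subset using (Subset; _∈_; _∉_; _⊆_; ∣_∣)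
open import Data.Product using (Σ; ∃; _×_)
open import Data.Sum using (_⊎_)
open import Relation.Nullary using (¬_)
open import Relation.Binary.PropositionalEquality using (_≡_; _≢_)
open import Function.Bundles using (_⇔_)

record Graph (n : ℕ) : Set₁ where
  field
    Adj    : Fin n → Fin n → Set
    sym    : ∀ {u v} → Adj u v → Adj v u
    irrefl : ∀ {v} → ¬ Adj v v
open Graph public

module _ {n : ℕ} (G : Graph n) where

  IsIntervalInduced : Subset n → Set
  IsIntervalInduced U =
    Σ (Fin n → ℕ) λ l → Σ (Fin n → ℕ) λ r →
      (∀ v → v ∈ U → l v ≤ r v) ×
      (∀ u v → u ∈ U → v ∈ U → u ≢ v → (Adj G u v ⇔ (l u ≤ r v × l v ≤ r u)))

  -- G[U] is a maximum induced interval subgraph of G[M]  (U ⊆ M).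
  -- Note (G[M])[U] = G[U] for U ⊆ M.
  IsMaxIntervalWithin : Subset n → Subset n → Set
  IsMaxIntervalWithin M U =
    U ⊆ M × IsIntervalInduced U ×
    (∀ W → W ⊆ M → IsIntervalInduced W → ∣ W ∣ ≤ ∣ U ∣)

  IsMaxInterval : Subset n → Set
  IsMaxInterval U =
    IsIntervalInduced U × (∀ W → IsIntervalInduced W → ∣ W ∣ ≤ ∣ U ∣)

  IsModule : Subset n → Set
  IsModule M =
    ∀ x → x ∉ M → (∀ m → m ∈ M → Adj G x m) ⊎ (∀ m → m ∈ M → ¬ Adj G x m)

  InNbhd : Subset n → Fin n → Set
  InNbhd M x = x ∉ M × ∃ λ m → m ∈ M × Adj G x m

  IsClique : (Fin n → Set) → Set
  IsClique P = ∀ u v → P u → P v → u ≢ v → Adj G u v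

-- Replacing U ∩ M by UM cannot shrink U, because G[U ∩ M] is itself an interval
-- subgraph of G[M]; so only the interval property of G[(U ─ M) ∪ UM] is at stake.
-- Fix v ∈ U ∩ M and an interval model of G[U]. As M is a module, a vertex of
-- U ─ M is adjacent to all of UM or to none of it, according as its interval
-- meets the interval of v. If M is a clique, every vertex of UM gets the
-- interval of v. If N(M) is a clique, the intervals of v and of its neighbours
-- in U ─ M pairwise meet and hence share a point p; opening the line at p and
-- inserting a gap that holds an interval model of G[UM] makes that model meet
-- exactly the intervals that contained p.
module Submission where

open import Data.Bool using (if_then_else_)
open import Data.Empty using (⊥-elim)
open import Data.Fin as Fin using (Fin; _≟_)
open import Data.Fin.Subset using (Subset; inside; outside; _∈_; _∉_; _⊆_; _∪_; _∩_; _─_; ∣_∣; Empty)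
open import Data.Fin.Subset.Properties using (_∈?_; drop-∷-Empty; x∈p∪q⁻; x∈p∩q⁻; p∩q⊆p; p∩q⊆q; p─q⊆p)
open import Data.Nat using (ℕ; zero; suc; _≤_; _+_; _⊔_; _≤?_; _<?_; z≤n)
open import Data.Nat.Properties
  using (≤-refl; ≤-trans; <-trans; <-≤-trans; ≤-<-trans; <⇒≱; ≮⇒≥; ≰⇒>; +-suc; m≤m+n; +-mono-≤;
         +-monoˡ-≤; +-monoʳ-≤; +-monoˡ-<; +-cancelˡ-≤; +-cancelʳ-≤; m≤m⊔n; m≤n⊔m; ⊔-lub; module ≤-Reasoning)
open import Data.Product using (∃; _×_; _,_; proj₁; proj₂; swap)
open import Data.Product.Function.NonDependent.Propositional using (_×-⇔_)
open import Data.Sum using (_⊎_; inj₁; inj₂; [_,_]′)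
open import Data.Vec using ([]; _∷_; here; there)
open import Defs
open import Function using (_∘_; const)
open import Function.Bundles using (_⇔_; mk⇔; Equivalence)
import Function.Properties.Equivalence as ⇔
open import Relation.Binary.PropositionalEquality as ≡ using (_≡_; _≢_; refl; cong; subst; subst₂)
open import Relation.Nullary using (does; yes; no; contradiction)
open import Relation.Nullary.Decidable using (dec-true; dec-false; _×-dec_; _⊎-dec_; ¬?)
open import Relation.Unary using (Decidable)
open Equivalence using (to; from)

private
  variable
    n : ℕ
    a b c d : ℕ
    x : Fin n
    A B M U W : Subset n
    f g l r l′ r′ la ra lb rb : Fin n → ℕ

x∈p─q⇒x∉q : ∀ {p q : Subset n} → x ∈ p ─ q → x ∉ q
x∈p─q⇒x∉q {p = _ ∷ _} {q = outside ∷ _} here ()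
x∈p─q⇒x∉q {p = _ ∷ p} {q = _ ∷ q} (there x∈p─q) (there x∈q) = x∈p─q⇒x∉q {p = p} {q = q} x∈p─q x∈q

∣p∣≡∣p─q∣+∣p∩q∣ : ∀ (p q : Subset n) → ∣ p ∣ ≡ ∣ p ─ q ∣ + ∣ p ∩ q ∣
∣p∣≡∣p─q∣+∣p∩q∣ []            []            = refl
∣p∣≡∣p─q∣+∣p∩q∣ (inside  ∷ p) (inside  ∷ q) = ≡.trans (cong suc (∣p∣≡∣p─q∣+∣p∩q∣ p q)) (≡.sym (+-suc _ _))
∣p∣≡∣p─q∣+∣p∩q∣ (inside  ∷ p) (outside ∷ q) = cong suc (∣p∣≡∣p─q∣+∣p∩q∣ p q)
∣p∣≡∣p─q∣+∣p∩q∣ (outside ∷ p) (inside  ∷ q) = ∣p∣≡∣p─q∣+∣p∩q∣ p q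
∣p∣≡∣p─q∣+∣p∩q∣ (outside ∷ p) (outside ∷ q) = ∣p∣≡∣p─q∣+∣p∩q∣ p q

∣p∪q∣≡∣p∣+∣q∣ : ∀ (p q : Subset n) → Empty (p ∩ q) → ∣ p ∪ q ∣ ≡ ∣ p ∣ + ∣ q ∣
∣p∪q∣≡∣p∣+∣q∣ []       []       _ = refl
∣p∪q∣≡∣p∣+∣q∣ (inside  ∷ p) (inside  ∷ q) p∩q≡∅ = ⊥-elim (p∩q≡∅ (Fin.zero , here))
∣p∪q∣≡∣p∣+∣q∣ (inside  ∷ p) (outside ∷ q) p∩q≡∅ = cong suc (∣p∪q∣≡∣p∣+∣q∣ p q (drop-∷-Empty p∩q≡∅))
∣p∪q∣≡∣p∣+∣q∣ (outside ∷ p) (inside  ∷ q) p∩q≡∅ =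
  ≡.trans (cong suc (∣p∪q∣≡∣p∣+∣q∣ p q (drop-∷-Empty p∩q≡∅))) (≡.sym (+-suc _ _))
∣p∪q∣≡∣p∣+∣q∣ (outside ∷ p) (outside ∷ q) p∩q≡∅ = ∣p∪q∣≡∣p∣+∣q∣ p q (drop-∷-Empty p∩q≡∅)

∣p∣≤∣p─q∪r∣ : ∀ (p : Subset n) {q r} → r ⊆ q → ∣ p ∩ q ∣ ≤ ∣ r ∣ → ∣ p ∣ ≤ ∣ (p ─ q) ∪ r ∣
∣p∣≤∣p─q∪r∣ p {q} {r} r⊆q ∣p∩q∣≤∣r∣ = begin
  ∣ p ∣                  ≡⟨ ∣p∣≡∣p─q∣+∣p∩q∣ p q ⟩
  ∣ p ─ q ∣ + ∣ p ∩ q ∣  ≤⟨ +-monoʳ-≤ ∣ p ─ q ∣ ∣p∩q∣≤∣r∣ ⟩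
  ∣ p ─ q ∣ + ∣ r ∣      ≡⟨ ∣p∪q∣≡∣p∣+∣q∣ (p ─ q) r disjoint ⟨
  ∣ (p ─ q) ∪ r ∣        ∎
  where
  open ≤-Reasoning
  disjoint : Empty ((p ─ q) ∩ r)
  disjoint (x , x∈) with x∈p∩q⁻ (p ─ q) r x∈
  ... | x∈p─q , x∈r = x∈p─q⇒x∉q x∈p─q (r⊆q x∈r)

sup : (Fin n → ℕ) → ℕ
sup {zero}  f = 0
sup {suc n} f = f Fin.zero ⊔ sup (f ∘ Fin.suc)

≤-sup : ∀ (f : Fin n → ℕ) x → f x ≤ sup f
≤-sup f Fin.zero    = m≤m⊔n _ _
≤-sup f (Fin.suc x) = ≤-trans (≤-sup (f ∘ Fin.suc) x) (m≤n⊔m _ _)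

sup-least : (∀ x → f x ≤ c) → sup f ≤ c
sup-least {zero}  _   = z≤n
sup-least {suc n} f≤c = ⊔-lub (f≤c Fin.zero) (sup-least (f≤c ∘ Fin.suc))

Overlap : ℕ → ℕ → ℕ → ℕ → Set
Overlap a b c d = a ≤ d × c ≤ b

overlap-sym : Overlap a b c d ⇔ Overlap c d a b
overlap-sym = mk⇔ swap swap

-- Helly's property in dimension one: the largest left endpoint is a common point.
common-point : ∀ {P : Fin n → Set} → Decidable P → (l r : Fin n → ℕ) →
               (∀ {x y} → P x → P y → l x ≤ r y) →
               ∃ λ p → ∀ {x} → P x → l x ≤ p × p ≤ r x
common-point {P = P} P? l r overlapping = sup lᴾ , λ Px → ≤-trans (l≤lᴾ Px) (≤-sup lᴾ _) , sup-least (lᴾ≤r Px)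
  where
  lᴾ : Fin _ → ℕ
  lᴾ y = if does (P? y) then l y else 0
  l≤lᴾ : ∀ {x} → P x → l x ≤ lᴾ x
  l≤lᴾ {x} Px rewrite dec-true (P? x) Px = ≤-refl
  lᴾ≤r : ∀ {x} → P x → ∀ y → lᴾ y ≤ r x
  lᴾ≤r Px y with P? y
  ... | yes Py = overlapping Py Px
  ... | no  _  = z≤n

-- Open the line at p and insert a gap of length D: left endpoints ≤ p and right
-- endpoints < p stay, all others move right by D.
module Stretch (p D : ℕ) where

  stretchˡ : ℕ → ℕ
  stretchˡ a with a ≤? p
  ... | yes _ = a
  ... | no  _ = a + D

  stretchʳ : ℕ → ℕ
  stretchʳ b with b <? p
  ... | yes _ = b
  ... | no  _ = b + D

  stretch-≤⇔ : a ≤ b ⇔ stretchˡ a ≤ stretchʳ b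
  stretch-≤⇔ {a} {b} with a ≤? p | b <? p
  ... | yes a≤p | yes b<p = ⇔.refl
  ... | yes a≤p | no  b≮p = mk⇔ (λ _ → ≤-trans a≤b (m≤m+n b D)) (λ _ → a≤b)
    where a≤b = ≤-trans a≤p (≮⇒≥ b≮p)
  ... | no  a≰p | yes b<p = mk⇔ (⊥-elim ∘ <⇒≱ b<a) (⊥-elim ∘ <⇒≱ (<-≤-trans b<a (m≤m+n a D)))
    where b<a = <-trans b<p (≰⇒> a≰p)
  ... | no  a≰p | no  b≮p = mk⇔ (+-monoˡ-≤ D) (+-cancelʳ-≤ D a b)

  stretch-overlap⇔ : c ≤ d → d ≤ D →
                     Overlap (stretchˡ a) (stretchʳ b) (p + c) (p + d) ⇔ (a ≤ p × p ≤ b)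
  stretch-overlap⇔ {c} {d} {a} {b} c≤d d≤D with a ≤? p | b <? p
  ... | yes a≤p | yes b<p =
        mk⇔ (λ (_ , p+c≤b) → contradiction (≤-trans (m≤m+n p c) p+c≤b) (<⇒≱ b<p))
            (λ (_ , p≤b) → contradiction p≤b (<⇒≱ b<p))
  ... | yes a≤p | no  b≮p =
        mk⇔ (λ _ → a≤p , ≮⇒≥ b≮p)
            (λ _ → ≤-trans a≤p (m≤m+n p d) , +-mono-≤ (≮⇒≥ b≮p) (≤-trans c≤d d≤D))
  ... | no  a≰p | _ =
        mk⇔ (λ (a+D≤p+d , _) → contradiction a+D≤p+d (<⇒≱ p+d<a+D))
            (λ (a≤p , _) → contradiction a≤p a≰p)
    where p+d<a+D = ≤-<-trans (+-monoʳ-≤ p d≤D) (+-monoˡ-< D (≰⇒> a≰p))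

piecewise : Subset n → (Fin n → ℕ) → (Fin n → ℕ) → Fin n → ℕ
piecewise M f g x = if does (x ∈? M) then f x else g x

piecewise-∈ : x ∈ M → piecewise M f g x ≡ f x
piecewise-∈ {x = x} {M = M} x∈M rewrite dec-true (x ∈? M) x∈M = refl

piecewise-∉ : x ∉ M → piecewise M f g x ≡ g x
piecewise-∉ {x = x} {M = M} x∉M rewrite dec-false (x ∈? M) x∉M = refl

overlap-cong : ∀ {a′ b′ c′ d′} → a ≡ a′ → b ≡ b′ → c ≡ c′ → d ≡ d′ → Overlap a b c d ≡ Overlap a′ b′ c′ d′
overlap-cong refl refl refl refl = refl

module _ (G : Graph n) where

  -- IsIntervalInduced G U unfolds to ∃ l r. Represents U l r.
  Represents : Subset n → (Fin n → ℕ) → (Fin n → ℕ) → Set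
  Represents U l r =
    (∀ v → v ∈ U → l v ≤ r v) ×
    (∀ u v → u ∈ U → v ∈ U → u ≢ v → (Adj G u v ⇔ Overlap (l u) (r u) (l v) (r v)))

  represents-⊆ : W ⊆ U → Represents U l r → Represents W l r
  represents-⊆ W⊆U (ok , rep) = (λ v → ok v ∘ W⊆U) , (λ u v u∈W v∈W → rep u v (W⊆U u∈W) (W⊆U v∈W))

  represents-∘ : ∀ {φ ψ : ℕ → ℕ} → (∀ {a b} → a ≤ b ⇔ φ a ≤ ψ b) →
                 Represents U l r → Represents U (φ ∘ l) (ψ ∘ r)
  represents-∘ φψ (ok , rep) =
    (λ v v∈U → to φψ (ok v v∈U)) ,
    (λ u v u∈U v∈U u≢v → ⇔.trans (rep u v u∈U v∈U u≢v) (φψ ×-⇔ φψ))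

  represents-cong : (∀ {x} → x ∈ U → l x ≡ l′ x) → (∀ {x} → x ∈ U → r x ≡ r′ x) →
                    Represents U l r → Represents U l′ r′
  represents-cong l≡l′ r≡r′ (ok , rep) =
    (λ v v∈U → subst₂ _≤_ (l≡l′ v∈U) (r≡r′ v∈U) (ok v v∈U)) ,
    (λ u v u∈U v∈U u≢v → subst (Adj G u v ⇔_)
       (overlap-cong (l≡l′ u∈U) (r≡r′ u∈U) (l≡l′ v∈U) (r≡r′ v∈U)) (rep u v u∈U v∈U u≢v))

  represents-∪ : ∀ {l r} → Represents A l r → Represents B l r →
                 (∀ x w → x ∈ A → w ∈ B → x ≢ w → Adj G x w ⇔ Overlap (l x) (r x) (l w) (r w)) →
                 Represents (A ∪ B) l r
  represents-∪ {A = A} {B = B} {l} {r} (okA , repA) (okB , repB) cross = ok , rep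
    where
    ok : ∀ v → v ∈ A ∪ B → l v ≤ r v
    ok v v∈A∪B = [ okA v , okB v ]′ (x∈p∪q⁻ A B v∈A∪B)
    rep : ∀ u v → u ∈ A ∪ B → v ∈ A ∪ B → u ≢ v → Adj G u v ⇔ Overlap (l u) (r u) (l v) (r v)
    rep u v u∈A∪B v∈A∪B u≢v with x∈p∪q⁻ A B u∈A∪B | x∈p∪q⁻ A B v∈A∪B
    ... | inj₁ u∈A | inj₁ v∈A = repA u v u∈A v∈A u≢v
    ... | inj₂ u∈B | inj₂ v∈B = repB u v u∈B v∈B u≢v
    ... | inj₁ u∈A | inj₂ v∈B = cross u v u∈A v∈B u≢v
    ... | inj₂ u∈B | inj₁ v∈A =
          ⇔.trans (mk⇔ (sym G) (sym G)) (⇔.trans (cross v u v∈A u∈B (≡.≢-sym u≢v)) overlap-sym)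

  represents-piecewise : (M : Subset n) → (∀ {x} → x ∈ A → x ∉ M) → B ⊆ M →
                         Represents A la ra → Represents B lb rb →
                         (∀ {x w} → x ∈ A → w ∈ B → Adj G x w ⇔ Overlap (la x) (ra x) (lb w) (rb w)) →
                         Represents (A ∪ B) (piecewise M lb la) (piecewise M rb ra)
  represents-piecewise {A = A} {B = B} {la = la} {ra = ra} {lb = lb} {rb = rb} M A∌ B⊆M A-rep B-rep cross =
    represents-∪ (represents-cong (on-A lb la) (on-A rb ra) A-rep)
                 (represents-cong (on-B lb la) (on-B rb ra) B-rep)
                 (λ x w x∈A w∈B _ → subst (Adj G x w ⇔_)
                    (overlap-cong (on-A lb la x∈A) (on-A rb ra x∈A) (on-B lb la w∈B) (on-B rb ra w∈B))
                    (cross x∈A w∈B))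
    where
    on-A : ∀ (f g : Fin n → ℕ) {x} → x ∈ A → g x ≡ piecewise M f g x
    on-A f g x∈A = ≡.sym (piecewise-∉ {f = f} {g = g} (A∌ x∈A))
    on-B : ∀ (f g : Fin n → ℕ) {x} → x ∈ B → f x ≡ piecewise M f g x
    on-B f g x∈B = ≡.sym (piecewise-∈ {f = f} {g = g} (B⊆M x∈B))

  represents-const : IsClique G (_∈ U) → a ≤ b → Represents U (const a) (const b)
  represents-const clique a≤b =
    (λ _ _ → a≤b) , (λ u v u∈U v∈U u≢v → mk⇔ (const (a≤b , a≤b)) (const (clique u v u∈U v∈U u≢v)))

  module-adj⇔ : ∀ {x w v} → IsModule G M → x ∉ M → w ∈ M → v ∈ M → Adj G x w ⇔ Adj G x v
  module-adj⇔ {x = x} M-module x∉M w∈M v∈M with M-module x x∉M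
  ... | inj₁ all  = mk⇔ (const (all _ v∈M)) (const (all _ w∈M))
  ... | inj₂ none = mk⇔ (⊥-elim ∘ none _ w∈M) (⊥-elim ∘ none _ v∈M)

module ReplaceModulePart
  (G : Graph n) {U M UM : Subset n} {l r lM rM : Fin n → ℕ} {v : Fin n}
  (M-module : IsModule G M) (v∈M : v ∈ M) (v∈U : v ∈ U)
  (U-rep : Represents G U l r) (UM⊆M : UM ⊆ M) (UM-rep : Represents G UM lM rM)
  where

  private
    U-ok : ∀ x → x ∈ U → l x ≤ r x
    U-ok = proj₁ U-rep

    U-adj : ∀ x y → x ∈ U → y ∈ U → x ≢ y → Adj G x y ⇔ Overlap (l x) (r x) (l y) (r y)
    U-adj = proj₂ U-rep

    U─M-rep : Represents G (U ─ M) l r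
    U─M-rep = represents-⊆ G (p─q⊆p U M) U-rep

    ∉M⇒≢v : ∀ {x} → x ∉ M → x ≢ v
    ∉M⇒≢v x∉M refl = x∉M v∈M

    adj⇔overlap-v : ∀ {x w} → x ∈ U ─ M → w ∈ M → Adj G x w ⇔ Overlap (l x) (r x) (l v) (r v)
    adj⇔overlap-v {x} x∈U─M w∈M =
      ⇔.trans (module-adj⇔ G M-module x∉M w∈M v∈M) (U-adj x v (p─q⊆p U M x∈U─M) v∈U (∉M⇒≢v x∉M))
      where x∉M = x∈p─q⇒x∉q x∈U─M

  replace-when-clique : IsClique G (_∈ M) → IsIntervalInduced G ((U ─ M) ∪ UM)
  replace-when-clique clique =
    piecewise M (const (l v)) l , piecewise M (const (r v)) r ,
    represents-piecewise G M x∈p─q⇒x∉q UM⊆M U─M-rep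
      (represents-const G (λ u w u∈UM w∈UM → clique u w (UM⊆M u∈UM) (UM⊆M w∈UM)) (U-ok v v∈U))
      (λ x∈U─M w∈UM → adj⇔overlap-v x∈U─M (UM⊆M w∈UM))

  replace-when-nbhd-clique : IsClique G (InNbhd G M) → IsIntervalInduced G ((U ─ M) ∪ UM)
  replace-when-nbhd-clique clique =
    piecewise M ((p +_) ∘ lM) (stretchˡ ∘ l) , piecewise M ((p +_) ∘ rM) (stretchʳ ∘ r) ,
    represents-piecewise G M x∈p─q⇒x∉q UM⊆M
      (represents-∘ G stretch-≤⇔ U─M-rep)
      (represents-∘ G (mk⇔ (+-monoʳ-≤ p) (+-cancelˡ-≤ p _ _)) UM-rep)
      cross
    where
    Core : Fin n → Set
    Core x = x ∈ U × (x ≡ v ⊎ x ∉ M) × Overlap (l x) (r x) (l v) (r v)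

    core? : Decidable Core
    core? x = x ∈? U ×-dec (x ≟ v ⊎-dec ¬? (x ∈? M)) ×-dec l x ≤? r v ×-dec l v ≤? r x

    core-nbhd : ∀ {x} → x ∈ U → x ∉ M → Overlap (l x) (r x) (l v) (r v) → InNbhd G M x
    core-nbhd {x} x∈U x∉M x~v = x∉M , v , v∈M , from (U-adj x v x∈U v∈U (∉M⇒≢v x∉M)) x~v

    core-overlapping : ∀ {x y} → Core x → Core y → l x ≤ r y
    core-overlapping (_ , inj₁ refl , _)          (_ , inj₁ refl , _)          = U-ok v v∈U
    core-overlapping (_ , inj₁ refl , _)          (_ , inj₂ _ , (_ , lv≤ry))  = lv≤ry
    core-overlapping (_ , inj₂ _ , (lx≤rv , _))  (_ , inj₁ refl , _)          = lx≤rv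
    core-overlapping {x} {y} (x∈U , inj₂ x∉M , x~v) (y∈U , inj₂ y∉M , y~v) with x ≟ y
    ... | yes refl = U-ok x x∈U
    ... | no  x≢y  = proj₁ (to (U-adj x y x∈U y∈U x≢y)
                               (clique x y (core-nbhd x∈U x∉M x~v) (core-nbhd y∈U y∉M y~v) x≢y))

    p : ℕ
    p = proj₁ (common-point core? l r core-overlapping)

    p-common : ∀ {x} → Core x → l x ≤ p × p ≤ r x
    p-common = proj₂ (common-point core? l r core-overlapping)

    D : ℕ
    D = sup rM

    open Stretch p D

    overlap-v⇔∋p : ∀ {x} → x ∈ U ─ M → Overlap (l x) (r x) (l v) (r v) ⇔ (l x ≤ p × p ≤ r x)
    overlap-v⇔∋p x∈U─M =
      mk⇔ (λ x~v → p-common (p─q⊆p U M x∈U─M , inj₂ (x∈p─q⇒x∉q x∈U─M) , x~v))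
          (λ (lx≤p , p≤rx) → ≤-trans lx≤p (proj₂ v-common) , ≤-trans (proj₁ v-common) p≤rx)
      where v-common = p-common (v∈U , inj₁ refl , U-ok v v∈U , U-ok v v∈U)

    cross : ∀ {x w} → x ∈ U ─ M → w ∈ UM →
            Adj G x w ⇔ Overlap (stretchˡ (l x)) (stretchʳ (r x)) (p + lM w) (p + rM w)
    cross {w = w} x∈U─M w∈UM =
      ⇔.trans (adj⇔overlap-v x∈U─M (UM⊆M w∈UM))
        (⇔.trans (overlap-v⇔∋p x∈U─M)
          (⇔.sym (stretch-overlap⇔ (proj₁ UM-rep w w∈UM) (≤-sup rM w))))

lemma3p1 : {n : ℕ} (G : Graph n) (U M : Subset n) →
    IsMaxInterval G U →
    IsModule G M →
    (IsClique G (λ v → v ∈ M) ⊎ IsClique G (InNbhd G M)) →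
    (∃ λ v → v ∈ M × v ∈ U) →
    (UM : Subset n) → IsMaxIntervalWithin G M UM →
    IsMaxInterval G ((U ─ M) ∪ UM)
lemma3p1 G U M ((l , r , U-rep) , U-max) M-module clique (v , v∈M , v∈U)
         UM (UM⊆M , (lM , rM , UM-rep) , UM-max) =
  [ replace-when-clique , replace-when-nbhd-clique ]′ clique ,
  λ W W-interval → ≤-trans (U-max W W-interval) ∣U∣≤∣U─M∪UM∣
  where
  open ReplaceModulePart G M-module v∈M v∈U U-rep UM⊆M UM-rep
  ∣U∣≤∣U─M∪UM∣ : ∣ U ∣ ≤ ∣ (U ─ M) ∪ UM ∣
  ∣U∣≤∣U─M∪UM∣ = ∣p∣≤∣p─q∪r∣ U UM⊆M
    (UM-max (U ∩ M) (p∩q⊆q U M) (l , r , represents-⊆ G (p∩q⊆p U M) U-rep))
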